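{- For $k\geq 1$ and $n\geq 0$, $g_k(n+1)\geq g_k(n)$ and $h_k(n+1)\geq h_k(n)$. Moreover, for $k\geq 2$ and $n\geq 0$, $k^2h_k(n)\leq n^2h_{k-1}(n)$.
   Context: For $k\geq 0$, $g_k(n)$ is the number of pairs $(\alpha,\beta)$ of partitions, each with at most $k$ parts, with $|\alpha|+|\beta|=n$; so $\sum_{n\geq0}g_k(n)q^n=1/(q;q)_k^2$. For $k\geq 2$, $h_k(n)$ is the number of pairs $(\alpha,\beta)$ of partitions, each with exactly $k$ parts, with $|\alpha|+|\beta|=n$ and such that the largest part of $\beta$ appears at least twice; $h_1(n)=1$ for $n\geq2$ and $h_1(0)=h_1(1)=0$; $h_k(n)=0$ for $n<0$. Thus for $k\geq 1$, $\sum_{n\geq0}h_k(n)q^n=\frac{q^{2k}}{(q;q)_k(q^2;q)_{k-1}}$, where $(a;q)_j=\prod_{i=0}^{j-1}(1-aq^i)$. -}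

module Defs where

open import Data.Nat using (ℕ; zero; suc; _+_; _≤ᵇ_; _≡ᵇ_)
open import Data.Bool using (Bool; true; false; _∧_)
open import Data.List using (List; []; _∷_; [_]; map; concatMap; upTo; length; filterᵇ; cartesianProduct)
open import Data.Vec using (Vec; []; _∷_; sum)
open import Data.Product using (_×_; _,_)

-- A partition with at most k parts is represented as a weakly decreasing
-- vector of k natural numbers (padded with zeros); its size is the sum.
-- A partition with exactly k parts is such a vector whose entries are all
-- positive (equivalently, whose last entry is positive).

vecsUpTo : (k b : ℕ) → List (Vec ℕ k)
vecsUpTo zero    b = [ [] ]
vecsUpTo (suc k) b = concatMap (λ x → map (x ∷_) (vecsUpTo k b)) (upTo (suc b))

isDecr : {k : ℕ} → Vec ℕ k → Bool
isDecr []            = true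
isDecr (x ∷ [])      = true
isDecr (x ∷ y ∷ xs)  = (y ≤ᵇ x) ∧ isDecr (y ∷ xs)

allPos : {k : ℕ} → Vec ℕ k → Bool
allPos []       = true
allPos (x ∷ xs) = (1 ≤ᵇ x) ∧ allPos xs

topTwice : {k : ℕ} → Vec ℕ k → Bool
topTwice (x ∷ y ∷ xs) = x ≡ᵇ y
topTwice _            = false

-- every part of a partition of size ≤ n is ≤ n, so vecsUpTo k n covers all
-- candidates for pairs with |α|+|β| = n.
pairsUpTo : (k n : ℕ) → List (Vec ℕ k × Vec ℕ k)
pairsUpTo k n = cartesianProduct (vecsUpTo k n) (vecsUpTo k n)

g : ℕ → ℕ → ℕ
g k n = length (filterᵇ ok (pairsUpTo k n))
  where
  ok : Vec ℕ k × Vec ℕ k → Bool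
  ok (a , b) = isDecr a ∧ isDecr b ∧ (sum a + sum b ≡ᵇ n)

hComb : ℕ → ℕ → ℕ
hComb k n = length (filterᵇ ok (pairsUpTo k n))
  where
  ok : Vec ℕ k × Vec ℕ k → Bool
  ok (a , b) = isDecr a ∧ isDecr b ∧ allPos a ∧ allPos b ∧ topTwice b
               ∧ (sum a + sum b ≡ᵇ n)

-- h 1 n = 1 for n ≥ 2, h 1 0 = h 1 1 = 0; h 0 is never used (set to 0)
h : ℕ → ℕ → ℕ
h zero          n               = 0
h (suc zero)    zero            = 0
h (suc zero)    (suc zero)      = 0
h (suc zero)    (suc (suc n))   = 1
h (suc (suc k)) n               = hComb (suc (suc k)) n

-- Raising the largest part of α by one maps the pairs of size n injectively to
-- pairs of size n + 1 and preserves all defining conditions; this gives both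
-- monotonicity statements.
-- For the ratio bound, remove the smallest parts L of α and M of β of a pair
-- counted by h_k(n) and add L + M to the largest part of α. This yields a pair
-- counted by h_{k-1}(n) which, together with L and M, determines the original one.
-- Since α and β are decreasing with k parts, k L ≤ n and k M ≤ n, so
-- h_k(n) ≤ ⌊n/k⌋² h_{k-1}(n), and k ⌊n/k⌋ ≤ n. For k = 2 a pair ((x, y), (c, c))
-- is already determined by n, y and c, which is what h_1(n) = 1 accounts for.
module Submission where

open import Defs
open import Data.Bool using (Bool; T; _∧_)
open import Data.Bool.Properties using (T-∧; T?)
open import Data.Empty using (⊥-elim)
open import Data.List using (List; []; _∷_; _++_; length; map; concatMap; upTo; filterᵇ; cartesianProduct; cartesianProductWith)
open import Data.List.Membership.Propositional using (_∈_; _─_)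
open import Data.List.Membership.Propositional.Properties using (∈-filter⁺; ∈-filter⁻; ∈-cartesianProduct⁺; ∈-cartesianProductWith⁺; ∈-upTo⁺)
open import Data.List.Properties using (length-++; length-map; length-upTo; length-removeAt′)
import Data.List.Relation.Unary.All as All
open import Data.List.Relation.Unary.AllPairs using ([]; _∷_)
open import Data.List.Relation.Unary.Any using (here; there; index)
open import Data.List.Relation.Unary.Unique.Propositional using (Unique)
import Data.List.Relation.Unary.Unique.Propositional.Properties as Unique
open import Data.Nat using (ℕ; zero; suc; _+_; _*_; _∸_; _≤_; _<_; _≤ᵇ_; _≡ᵇ_; z≤n; s≤s; pred; NonZero; >-nonZero)
open import Data.Nat.DivMod using (_/_; m/n*n≤m; m*n/n≡m; /-monoˡ-≤)
open import Data.Nat.Properties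
open import Data.Nat.Tactic.RingSolver using (solve-∀)
open import Data.Product using (_×_; _,_; proj₁; proj₂; map₁; <_,_>)
open import Data.Unit using (tt)
open import Data.Vec using (Vec; []; _∷_; sum; init; last; _∷ʳ_; initLast)
open import Data.Vec.Properties using (∷-injective)
open import Function using (_∘_; Equivalence)
open import Relation.Binary.PropositionalEquality

∈-─⁺ : {A : Set} {x z : A} {ys : List A} (x∈ys : x ∈ ys) → z ∈ ys → z ≢ x → z ∈ ys ─ x∈ys
∈-─⁺ (here refl)  (here refl)  z≢x = ⊥-elim (z≢x refl)
∈-─⁺ (here refl)  (there z∈ys) _   = z∈ys
∈-─⁺ (there _)    (here refl)  _   = here refl
∈-─⁺ (there x∈ys) (there z∈ys) z≢x = there (∈-─⁺ x∈ys z∈ys z≢x)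

length-≤-of-leftInverseOn : {A B : Set} (f : A → B) (f⁻¹ : B → A) {xs : List A} {ys : List B} →
                            Unique xs → (∀ {x} → x ∈ xs → f x ∈ ys) →
                            (∀ {x} → x ∈ xs → f⁻¹ (f x) ≡ x) → length xs ≤ length ys
length-≤-of-leftInverseOn f f⁻¹ {[]} _ _ _ = z≤n
length-≤-of-leftInverseOn f f⁻¹ {x ∷ xs} {ys} (x∉xs ∷ unique) f∈ys f⁻¹∘f≗id = begin
  suc (length xs)           ≤⟨ s≤s (length-≤-of-leftInverseOn f f⁻¹ unique f∈ys─fx (f⁻¹∘f≗id ∘ there)) ⟩
  suc (length (ys ─ fx∈ys)) ≡⟨ sym (length-removeAt′ ys (index fx∈ys)) ⟩
  length ys                 ∎
  where
  open ≤-Reasoning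
  fx∈ys : f x ∈ ys
  fx∈ys = f∈ys (here refl)
  f∈ys─fx : ∀ {y} → y ∈ xs → f y ∈ ys ─ fx∈ys
  f∈ys─fx y∈xs = ∈-─⁺ fx∈ys (f∈ys (there y∈xs)) λ fy≡fx →
    All.lookup x∉xs y∈xs
      (trans (sym (f⁻¹∘f≗id (here refl))) (trans (cong f⁻¹ (sym fy≡fx)) (f⁻¹∘f≗id (there y∈xs))))

length-cartesianProductWith : {A B C : Set} (f : A → B → C) (xs : List A) (ys : List B) →
                              length (cartesianProductWith f xs ys) ≡ length xs * length ys
length-cartesianProductWith f []       ys = refl
length-cartesianProductWith f (x ∷ xs) ys = begin
  length (map (f x) ys ++ cartesianProductWith f xs ys)   ≡⟨ length-++ (map (f x) ys) ⟩
  length (map (f x) ys) + length (cartesianProductWith f xs ys)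
    ≡⟨ cong₂ _+_ (length-map (f x) ys) (length-cartesianProductWith f xs ys) ⟩
  length ys + length xs * length ys                       ∎
  where
  open ≡-Reasoning

concatMap-map≡cartesianProductWith : {A B C : Set} (f : A → B → C) (xs : List A) (ys : List B) →
                                     concatMap (λ x → map (f x) ys) xs ≡ cartesianProductWith f xs ys
concatMap-map≡cartesianProductWith f []       ys = refl
concatMap-map≡cartesianProductWith f (x ∷ xs) ys =
  cong (map (f x) ys ++_) (concatMap-map≡cartesianProductWith f xs ys)

vecsUpTo-suc : ∀ k b → vecsUpTo (suc k) b ≡ cartesianProductWith _∷_ (upTo (suc b)) (vecsUpTo k b)
vecsUpTo-suc k b = concatMap-map≡cartesianProductWith _∷_ (upTo (suc b)) (vecsUpTo k b)

vecsUpTo-unique : ∀ k b → Unique (vecsUpTo k b)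
vecsUpTo-unique zero    b = All.[] ∷ []
vecsUpTo-unique (suc k) b = subst Unique (sym (vecsUpTo-suc k b))
  (Unique.cartesianProductWith⁺ _∷_ ∷-injective (Unique.upTo⁺ (suc b)) (vecsUpTo-unique k b))

∈-vecsUpTo : ∀ {k b} (v : Vec ℕ k) → sum v ≤ b → v ∈ vecsUpTo k b
∈-vecsUpTo []                   _     = here refl
∈-vecsUpTo {suc k} {b} (x ∷ v) sum≤b = subst (x ∷ v ∈_) (sym (vecsUpTo-suc k b))
  (∈-cartesianProductWith⁺ _∷_ (∈-upTo⁺ (s≤s (≤-trans (m≤m+n x (sum v)) sum≤b)))
                               (∈-vecsUpTo v (≤-trans (m≤n+m (sum v) x) sum≤b)))

Pair : ℕ → Set
Pair k = Vec ℕ k × Vec ℕ k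

module _ {k n : ℕ} (ok : Pair k → Bool) where

  ∈-filterᵇ-pairsUpTo : ∀ {a b} → sum a + sum b ≡ n → T (ok (a , b)) → (a , b) ∈ filterᵇ ok (pairsUpTo k n)
  ∈-filterᵇ-pairsUpTo {a} {b} size =
    ∈-filter⁺ (T? ∘ ok) (∈-cartesianProduct⁺ (∈-vecsUpTo a (subst (sum a ≤_) size (m≤m+n (sum a) (sum b))))
                                             (∈-vecsUpTo b (subst (sum b ≤_) size (m≤n+m (sum b) (sum a)))))

  length-filterᵇ-pairsUpTo-≤ : {P : Pair k → Set} → (∀ {p} → T (ok p) → P p) →
                               {B : Set} {ys : List B} (f : Pair k → B) (f⁻¹ : B → Pair k) →
                               (∀ {p} → P p → f p ∈ ys) → (∀ {p} → P p → f⁻¹ (f p) ≡ p) →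
                               length (filterᵇ ok (pairsUpTo k n)) ≤ length ys
  length-filterᵇ-pairsUpTo-≤ decode f f⁻¹ f∈ys f⁻¹∘f≗id =
    length-≤-of-leftInverseOn f f⁻¹
      (Unique.filter⁺ (T? ∘ ok) (Unique.cartesianProduct⁺ (vecsUpTo-unique k n) (vecsUpTo-unique k n)))
      (f∈ys ∘ decode ∘ proj₂ ∘ ∈-filter⁻ (T? ∘ ok) {xs = pairsUpTo k n})
      (f⁻¹∘f≗id ∘ decode ∘ proj₂ ∘ ∈-filter⁻ (T? ∘ ok) {xs = pairsUpTo k n})

T-∧⁻ : ∀ {x y} → T (x ∧ y) → T x × T y
T-∧⁻ = Equivalence.to T-∧

T-∧⁺ : ∀ {x y} → T x → T y → T (x ∧ y)
T-∧⁺ tx ty = Equivalence.from T-∧ (tx , ty)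

okG : (k n : ℕ) → Pair k → Bool
okG k n (a , b) = isDecr a ∧ isDecr b ∧ (sum a + sum b ≡ᵇ n)

okH : (k n : ℕ) → Pair k → Bool
okH k n (a , b) = isDecr a ∧ isDecr b ∧ allPos a ∧ allPos b ∧ topTwice b ∧ (sum a + sum b ≡ᵇ n)

record GPair {k : ℕ} (n : ℕ) (p : Pair k) : Set where
  field
    α-decreasing : T (isDecr (proj₁ p))
    β-decreasing : T (isDecr (proj₂ p))
    size         : sum (proj₁ p) + sum (proj₂ p) ≡ n

record HPair {k : ℕ} (n : ℕ) (p : Pair k) : Set where
  field
    α-decreasing : T (isDecr (proj₁ p))
    β-decreasing : T (isDecr (proj₂ p))
    α-positive   : T (allPos (proj₁ p))
    β-positive   : T (allPos (proj₂ p))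
    β-topTwice   : T (topTwice (proj₂ p))
    size         : sum (proj₁ p) + sum (proj₂ p) ≡ n

gPair⁻ : ∀ {k n} {p : Pair k} → T (okG k n p) → GPair n p
gPair⁻ {p = a , b} t =
  let αd , t₁ = T-∧⁻ t ; βd , s = T-∧⁻ t₁
  in record { α-decreasing = αd ; β-decreasing = βd ; size = ≡ᵇ⇒≡ (sum a + sum b) _ s }

hPair⁻ : ∀ {k n} {p : Pair k} → T (okH k n p) → HPair n p
hPair⁻ {p = a , b} t =
  let αd , t₁ = T-∧⁻ t ; βd , t₂ = T-∧⁻ t₁ ; αp , t₃ = T-∧⁻ t₂ ; βp , t₄ = T-∧⁻ t₃ ; βt , s = T-∧⁻ t₄
  in record { α-decreasing = αd ; β-decreasing = βd ; α-positive = αp ; β-positive = βp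
            ; β-topTwice = βt ; size = ≡ᵇ⇒≡ (sum a + sum b) _ s }

∈-gPairs : ∀ {k n} {p : Pair k} → GPair n p → p ∈ filterᵇ (okG k n) (pairsUpTo k n)
∈-gPairs {k} {n} {a , b} G =
  ∈-filterᵇ-pairsUpTo (okG k n) size (T-∧⁺ α-decreasing (T-∧⁺ β-decreasing (≡⇒≡ᵇ _ _ size)))
  where open GPair G

∈-hPairs : ∀ {k n} {p : Pair k} → HPair n p → p ∈ filterᵇ (okH k n) (pairsUpTo k n)
∈-hPairs {k} {n} {a , b} H =
  ∈-filterᵇ-pairsUpTo (okH k n) size
    (T-∧⁺ α-decreasing (T-∧⁺ β-decreasing (T-∧⁺ α-positive (T-∧⁺ β-positive (T-∧⁺ β-topTwice (≡⇒≡ᵇ _ _ size))))))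
  where open HPair H

isDecr-raiseHead : ∀ {m x y} (v : Vec ℕ m) → x ≤ y → T (isDecr (x ∷ v)) → T (isDecr (y ∷ v))
isDecr-raiseHead         []      _   _ = tt
isDecr-raiseHead {x = x} (z ∷ v) x≤y t =
  let z≤x , t′ = T-∧⁻ t in T-∧⁺ (≤⇒≤ᵇ (≤-trans (≤ᵇ⇒≤ z x z≤x) x≤y)) t′

allPos-raiseHead : ∀ {m x y} (v : Vec ℕ m) → x ≤ y → T (allPos (x ∷ v)) → T (allPos (y ∷ v))
allPos-raiseHead {x = x} _ x≤y t =
  let 1≤x , t′ = T-∧⁻ t in T-∧⁺ (≤⇒≤ᵇ (≤-trans (≤ᵇ⇒≤ 1 x 1≤x) x≤y)) t′

incHead : ∀ {m} → Vec ℕ (suc m) → Vec ℕ (suc m)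
incHead (x ∷ v) = suc x ∷ v

decHead : ∀ {m} → Vec ℕ (suc m) → Vec ℕ (suc m)
decHead (x ∷ v) = pred x ∷ v

decHead-incHead : ∀ {m} (v : Vec ℕ (suc m)) → decHead (incHead v) ≡ v
decHead-incHead (x ∷ v) = refl

gPair-incHead : ∀ {m n} {p : Pair (suc m)} → GPair n p → GPair (suc n) (map₁ incHead p)
gPair-incHead {p = x ∷ a , b} G = record
  { α-decreasing = isDecr-raiseHead a (n≤1+n x) α-decreasing
  ; β-decreasing = β-decreasing
  ; size         = cong suc size
  }
  where open GPair G

hPair-incHead : ∀ {m n} {p : Pair (suc m)} → HPair n p → HPair (suc n) (map₁ incHead p)
hPair-incHead {p = x ∷ a , b} H = record
  { α-decreasing = isDecr-raiseHead a (n≤1+n x) α-decreasing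
  ; β-decreasing = β-decreasing
  ; α-positive   = allPos-raiseHead a (n≤1+n x) α-positive
  ; β-positive   = β-positive
  ; β-topTwice   = β-topTwice
  ; size         = cong suc size
  }
  where open HPair H

g-monotone : ∀ k n → 1 ≤ k → g k n ≤ g k (suc n)
g-monotone (suc m) n _ = length-filterᵇ-pairsUpTo-≤ (okG (suc m) n) gPair⁻ (map₁ incHead) (map₁ decHead)
  (∈-gPairs ∘ gPair-incHead) (λ {(a , _)} _ → cong (_, _) (decHead-incHead a))

hComb-monotone : ∀ m n → hComb (suc m) n ≤ hComb (suc m) (suc n)
hComb-monotone m n = length-filterᵇ-pairsUpTo-≤ (okH (suc m) n) hPair⁻ (map₁ incHead) (map₁ decHead)
  (∈-hPairs ∘ hPair-incHead) (λ {(a , _)} _ → cong (_, _) (decHead-incHead a))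

h-monotone : ∀ k n → 1 ≤ k → h k n ≤ h k (suc n)
h-monotone 1             0             _ = z≤n
h-monotone 1             1             _ = z≤n
h-monotone 1             (suc (suc n)) _ = ≤-refl
h-monotone (suc (suc m)) n             _ = hComb-monotone (suc m) n

init-∷ʳ-last : ∀ {A : Set} {m} (v : Vec A (suc m)) → init v ∷ʳ last v ≡ v
init-∷ʳ-last v = sym (proj₂ (proj₂ (initLast v)))

sum-init-last : ∀ {m} (v : Vec ℕ (suc m)) → sum v ≡ sum (init v) + last v
sum-init-last (x ∷ [])    = +-comm x 0
sum-init-last (x ∷ y ∷ v) = trans (cong (x +_) (sum-init-last (y ∷ v))) (sym (+-assoc x _ _))

isDecr-init : ∀ {m} (v : Vec ℕ (suc m)) → T (isDecr v) → T (isDecr (init v))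
isDecr-init (x ∷ [])        _ = tt
isDecr-init (x ∷ y ∷ [])    _ = tt
isDecr-init (x ∷ y ∷ z ∷ v) t = let y≤x , t′ = T-∧⁻ t in T-∧⁺ y≤x (isDecr-init (y ∷ z ∷ v) t′)

allPos-init : ∀ {m} (v : Vec ℕ (suc m)) → T (allPos v) → T (allPos (init v))
allPos-init (x ∷ [])    _ = tt
allPos-init (x ∷ y ∷ v) t = let 1≤x , t′ = T-∧⁻ {1 ≤ᵇ x} t in T-∧⁺ 1≤x (allPos-init (y ∷ v) t′)

topTwice-init : ∀ {m} (v : Vec ℕ (3 + m)) → T (topTwice v) → T (topTwice (init v))
topTwice-init (x ∷ y ∷ z ∷ v) t = t

last-positive : ∀ {m} (v : Vec ℕ (suc m)) → T (allPos v) → 0 < last v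
last-positive (x ∷ [])    t = ≤ᵇ⇒≤ 1 x (proj₁ (T-∧⁻ t))
last-positive (x ∷ y ∷ v) t = last-positive (y ∷ v) (proj₂ (T-∧⁻ {1 ≤ᵇ x} t))

last≤head : ∀ {m} (x : ℕ) (v : Vec ℕ m) → T (isDecr (x ∷ v)) → last (x ∷ v) ≤ x
last≤head x []      _ = ≤-refl
last≤head x (y ∷ v) t = let y≤x , t′ = T-∧⁻ t in ≤-trans (last≤head y v t′) (≤ᵇ⇒≤ y x y≤x)

length*last≤sum : ∀ {m} (v : Vec ℕ (suc m)) → T (isDecr v) → suc m * last v ≤ sum v
length*last≤sum (x ∷ [])    _ = ≤-refl
length*last≤sum (x ∷ y ∷ v) t = +-mono-≤ (last≤head x (y ∷ v) t) (length*last≤sum (y ∷ v) (proj₂ (T-∧⁻ t)))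

m*n≤o⇒n≤o/m : ∀ m n o .{{_ : NonZero m}} → m * n ≤ o → n ≤ o / m
m*n≤o⇒n≤o/m m n o mn≤o = subst (_≤ o / m) (m*n/n≡m n m) (/-monoˡ-≤ m (subst (_≤ o) (*-comm m n) mn≤o))

pred-last<sum/length : ∀ {m n} (v : Vec ℕ (suc m)) → T (isDecr v) → T (allPos v) → sum v ≤ n →
                       pred (last v) < n / suc m
pred-last<sum/length {m} {n} v decreasing positive sum≤n =
  subst (_≤ n / suc m) (sym (suc-pred (last v))) (m*n≤o⇒n≤o/m (suc m) (last v) n (≤-trans (length*last≤sum v decreasing) sum≤n))
  where
  instance
    last≢0 : NonZero (last v)
    last≢0 = >-nonZero (last-positive v positive)

upTo² : ℕ → List (ℕ × ℕ)
upTo² q = cartesianProduct (upTo q) (upTo q)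

length-upTo² : ∀ q → length (upTo² q) ≡ q * q
length-upTo² q = trans (length-cartesianProductWith _,_ (upTo q) (upTo q)) (cong₂ _*_ (length-upTo q) (length-upTo q))

lastParts : ∀ {m} → Pair (suc m) → ℕ × ℕ
lastParts (a , b) = pred (last a) , pred (last b)

lastParts∈upTo² : ∀ {m n} {p : Pair (suc m)} → HPair n p → lastParts p ∈ upTo² (n / suc m)
lastParts∈upTo² {p = a , b} H = ∈-cartesianProduct⁺
  (∈-upTo⁺ (pred-last<sum/length a α-decreasing α-positive (subst (sum a ≤_) size (m≤m+n (sum a) (sum b)))))
  (∈-upTo⁺ (pred-last<sum/length b β-decreasing β-positive (subst (sum b ≤_) size (m≤n+m (sum b) (sum a)))))
  where open HPair H

dropLastParts : ∀ {m} → Pair (3 + m) → Pair (2 + m)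
dropLastParts (x ∷ r , b) = (x + (last r + last b)) ∷ init r , init b

restoreLastParts : ∀ {m} → Pair (2 + m) × (ℕ × ℕ) → Pair (3 + m)
restoreLastParts ((c ∷ r , b) , (s , t)) = (c ∸ (suc s + suc t)) ∷ (r ∷ʳ suc s) , b ∷ʳ suc t

hPair-dropLastParts : ∀ {m n} {p : Pair (3 + m)} → HPair n p → HPair n (dropLastParts p)
hPair-dropLastParts {n = n} {x ∷ r , b} H = record
  { α-decreasing = isDecr-raiseHead (init r) (m≤m+n x _) (isDecr-init (x ∷ r) α-decreasing)
  ; β-decreasing = isDecr-init b β-decreasing
  ; α-positive   = allPos-raiseHead (init r) (m≤m+n x _) (allPos-init (x ∷ r) α-positive)
  ; β-positive   = allPos-init b β-positive
  ; β-topTwice   = topTwice-init b β-topTwice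
  ; size         = size′
  }
  where
  open HPair H
  L = last r
  M = last b
  regroup : ∀ x L M s t → x + (L + M) + s + t ≡ x + (s + L) + (t + M)
  regroup = solve-∀
  size′ : x + (L + M) + sum (init r) + sum (init b) ≡ n
  size′ = begin
    x + (L + M) + sum (init r) + sum (init b)   ≡⟨ regroup x L M (sum (init r)) (sum (init b)) ⟩
    x + (sum (init r) + L) + (sum (init b) + M) ≡⟨ cong₂ (λ s t → x + s + t) (sum-init-last r) (sum-init-last b) ⟨
    x + sum r + sum b                           ≡⟨ size ⟩
    n                                           ∎
    where open ≡-Reasoning

restore∘dropLastParts : ∀ {m n} {p : Pair (3 + m)} → HPair n p →
                        restoreLastParts (< dropLastParts , lastParts > p) ≡ p
restore∘dropLastParts {p = x ∷ r , b} H = begin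
  (x + (L + M) ∸ (suc (pred L) + suc (pred M))) ∷ (init r ∷ʳ suc (pred L)) , init b ∷ʳ suc (pred M)
    ≡⟨ cong₂ (λ L′ M′ → (x + (L + M) ∸ (L′ + M′)) ∷ (init r ∷ʳ L′) , init b ∷ʳ M′) (suc-pred L) (suc-pred M) ⟩
  (x + (L + M) ∸ (L + M)) ∷ (init r ∷ʳ L) , init b ∷ʳ M
    ≡⟨ cong₂ (λ y s → y ∷ s , init b ∷ʳ M) (m+n∸n≡m x (L + M)) (init-∷ʳ-last r) ⟩
  x ∷ r , init b ∷ʳ M
    ≡⟨ cong (x ∷ r ,_) (init-∷ʳ-last b) ⟩
  x ∷ r , b ∎
  where
  open ≡-Reasoning
  open HPair H
  L = last r
  M = last b
  instance
    L≢0 : NonZero L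
    L≢0 = >-nonZero (last-positive (x ∷ r) α-positive)
    M≢0 : NonZero M
    M≢0 = >-nonZero (last-positive b β-positive)

hComb-≤-hComb*square : ∀ m n → hComb (3 + m) n ≤ hComb (2 + m) n * (n / (3 + m) * (n / (3 + m)))
hComb-≤-hComb*square m n = begin
  hComb (3 + m) n
    ≤⟨ length-filterᵇ-pairsUpTo-≤ {n = n} (okH (3 + m) n) hPair⁻ < dropLastParts , lastParts > restoreLastParts
         (λ H → ∈-cartesianProduct⁺ (∈-hPairs (hPair-dropLastParts H)) (lastParts∈upTo² H)) restore∘dropLastParts ⟩
  length (cartesianProduct (filterᵇ (okH (2 + m) n) (pairsUpTo (2 + m) n)) (upTo² q))
    ≡⟨ length-cartesianProductWith _,_ (filterᵇ (okH (2 + m) n) (pairsUpTo (2 + m) n)) (upTo² q) ⟩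
  hComb (2 + m) n * length (upTo² q)
    ≡⟨ cong (hComb (2 + m) n *_) (length-upTo² q) ⟩
  hComb (2 + m) n * (q * q) ∎
  where
  open ≤-Reasoning
  q = n / (3 + m)

fromLastParts₂ : ℕ → ℕ × ℕ → Pair 2
fromLastParts₂ n (s , t) = (n ∸ (suc s + (suc t + suc t))) ∷ suc s ∷ [] , suc t ∷ suc t ∷ []

fromLastParts₂∘lastParts : ∀ {n} {p : Pair 2} → HPair n p → fromLastParts₂ n (lastParts p) ≡ p
fromLastParts₂∘lastParts {n} {x ∷ y ∷ [] , c ∷ d ∷ []} H with ≡ᵇ⇒≡ c d (HPair.β-topTwice H)
... | refl = begin
  (n ∸ (suc (pred y) + (suc (pred c) + suc (pred c)))) ∷ suc (pred y) ∷ [] , suc (pred c) ∷ suc (pred c) ∷ []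
    ≡⟨ cong₂ (λ y′ c′ → (n ∸ (y′ + (c′ + c′))) ∷ y′ ∷ [] , c′ ∷ c′ ∷ []) (suc-pred y) (suc-pred c) ⟩
  (n ∸ (y + (c + c))) ∷ y ∷ [] , c ∷ c ∷ []
    ≡⟨ cong (λ x′ → x′ ∷ y ∷ [] , c ∷ c ∷ []) largest-part ⟩
  x ∷ y ∷ [] , c ∷ c ∷ [] ∎
  where
  open ≡-Reasoning
  open HPair H
  instance
    y≢0 : NonZero y
    y≢0 = >-nonZero (last-positive (x ∷ y ∷ []) α-positive)
    c≢0 : NonZero c
    c≢0 = >-nonZero (last-positive (c ∷ c ∷ []) β-positive)
  regroup : ∀ x y c → x + (y + 0) + (c + (c + 0)) ≡ x + (y + (c + c))
  regroup = solve-∀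
  largest-part : n ∸ (y + (c + c)) ≡ x
  largest-part = trans (cong (_∸ (y + (c + c))) (trans (sym size) (regroup x y c))) (m+n∸n≡m x (y + (c + c)))

hComb₂-≤-square : ∀ n → hComb 2 n ≤ n / 2 * (n / 2)
hComb₂-≤-square n = begin
  hComb 2 n
    ≤⟨ length-filterᵇ-pairsUpTo-≤ {n = n} (okH 2 n) hPair⁻ lastParts (fromLastParts₂ n) lastParts∈upTo² fromLastParts₂∘lastParts ⟩
  length (upTo² (n / 2))
    ≡⟨ length-upTo² (n / 2) ⟩
  n / 2 * (n / 2) ∎
  where open ≤-Reasoning

h-≤-h-pred*square : ∀ k n .{{_ : NonZero k}} → 2 ≤ k → h k n ≤ h (k ∸ 1) n * (n / k * (n / k))
h-≤-h-pred*square 1                   n             (s≤s ())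
h-≤-h-pred*square 2                   0             _ = hComb₂-≤-square 0
h-≤-h-pred*square 2                   1             _ = hComb₂-≤-square 1
h-≤-h-pred*square 2                   (suc (suc n)) _ =
  subst (hComb 2 (2 + n) ≤_) (sym (*-identityˡ _)) (hComb₂-≤-square (2 + n))
h-≤-h-pred*square (suc (suc (suc m))) n             _ = hComb-≤-hComb*square m n

q*k≤n⇒k*k*h≤n*n*h′ : ∀ k n q {h h′} → q * k ≤ n → h ≤ h′ * (q * q) → k * k * h ≤ n * n * h′
q*k≤n⇒k*k*h≤n*n*h′ k n q {h} {h′} qk≤n h≤h′qq = begin
  k * k * h              ≤⟨ *-monoʳ-≤ (k * k) h≤h′qq ⟩
  k * k * (h′ * (q * q)) ≡⟨ regroup k q h′ ⟩
  q * k * (q * k) * h′   ≤⟨ *-monoˡ-≤ h′ (*-mono-≤ qk≤n qk≤n) ⟩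
  n * n * h′             ∎
  where
  open ≤-Reasoning
  regroup : ∀ k q h′ → k * k * (h′ * (q * q)) ≡ q * k * (q * k) * h′
  regroup = solve-∀

h-ratio-bound : ∀ k n → 2 ≤ k → k * k * h k n ≤ n * n * h (k ∸ 1) n
h-ratio-bound k@(suc _) n 2≤k =
  q*k≤n⇒k*k*h≤n*n*h′ k n (n / k) (m/n*n≤m n k) (h-≤-h-pred*square k n 2≤k)

lemma9p3 : ((k n : ℕ) → 1 ≤ k → g k n ≤ g k (suc n))
         × ((k n : ℕ) → 1 ≤ k → h k n ≤ h k (suc n))
         × ((k n : ℕ) → 2 ≤ k → k * k * h k n ≤ n * n * h (k ∸ 1) n)
lemma9p3 = g-monotone , h-monotone , h-ratio-bound
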